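{- Let $f:\{0,1,2\}^*\to\{0,1,2\}^*$, $\varphi:\{0,1,2,3,4\}^*\to\{0,1,2,3,4\}^*$ and $\psi:\{0,1,2,3,4\}^*\to\{0,1,2\}^*$ be the morphisms given by $f(0)=01,\ f(1)=022,\ f(2)=02$; $\varphi(0)=01,\ \varphi(1)=02,\ \varphi(2)=03,\ \varphi(3)=04,\ \varphi(4)=044$; $\psi(0)=0,\ \psi(1)=1,\ \psi(2)=22,\ \psi(3)=202,\ \psi(4)=20102$. Then $f^n\circ\psi=\psi\circ\varphi^n$ for every $n\in\mathbb N$ (with $f^0$ and $\varphi^0$ the identity maps).
   Context: A morphism is a map $h$ between free monoids of words with $h(uv)=h(u)h(v)$; it is determined by the images of letters. $h^n$ denotes the $n$-fold composition. -}

module Defs where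

open import Data.Nat using (ℕ; zero; suc)
open import Data.Fin using (Fin; zero; suc)
open import Data.List using (List; []; _∷_; concatMap)
open import Function using (_∘_; id)

c0 : {k : ℕ} → Fin (suc k)
c0 = zero
c1 : {k : ℕ} → Fin (suc (suc k))
c1 = suc zero
c2 : {k : ℕ} → Fin (suc (suc (suc k)))
c2 = suc (suc zero)
c3 : {k : ℕ} → Fin (suc (suc (suc (suc k))))
c3 = suc (suc (suc zero))
c4 : {k : ℕ} → Fin (suc (suc (suc (suc (suc k)))))
c4 = suc (suc (suc (suc zero)))

Word : ℕ → Set
Word k = List (Fin k)

morph : {k l : ℕ} → (Fin k → Word l) → Word k → Word l
morph σ = concatMap σ

iter : {A : Set} → ℕ → (A → A) → A → A
iter zero    h = id
iter (suc n) h = h ∘ iter n h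

fσ : Fin 3 → Word 3
fσ zero             = c0 ∷ c1 ∷ []
fσ (suc zero)       = c0 ∷ c2 ∷ c2 ∷ []
fσ (suc (suc zero)) = c0 ∷ c2 ∷ []

φσ : Fin 5 → Word 5
φσ zero                         = c0 ∷ c1 ∷ []
φσ (suc zero)                   = c0 ∷ c2 ∷ []
φσ (suc (suc zero))             = c0 ∷ c3 ∷ []
φσ (suc (suc (suc zero)))       = c0 ∷ c4 ∷ []
φσ (suc (suc (suc (suc zero)))) = c0 ∷ c4 ∷ c4 ∷ []

ψσ : Fin 5 → Word 3
ψσ zero                         = c0 ∷ []
ψσ (suc zero)                   = c1 ∷ []
ψσ (suc (suc zero))             = c2 ∷ c2 ∷ []
ψσ (suc (suc (suc zero)))       = c2 ∷ c0 ∷ c2 ∷ []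
ψσ (suc (suc (suc (suc zero)))) = c2 ∷ c0 ∷ c1 ∷ c0 ∷ c2 ∷ []

f : Word 3 → Word 3
f = morph fσ

φ : Word 5 → Word 5
φ = morph φσ

ψ : Word 5 → Word 3
ψ = morph ψσ

-- It suffices to check ψ ∘ φ = f ∘ ψ on the five letters, since both sides are
-- morphisms; the identity for f^n and φ^n then follows by induction on n.
module Submission where

open import Defs
open import Data.Nat using (ℕ; zero; suc)
open import Data.Fin using (Fin; zero; suc)
open import Data.List using ([]; _∷_; _++_)
open import Data.List.Properties using (concatMap-++)
open import Function using (_∘_)
open import Relation.Binary.PropositionalEquality using (_≡_; _≗_; refl; trans; cong; cong₂)
open Relation.Binary.PropositionalEquality.≡-Reasoning

morph-conjugate : {k l m n : ℕ} (σ : Fin l → Word m) (τ : Fin k → Word l)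
                  (ρ : Fin k → Word n) (χ : Fin n → Word m) →
                  (∀ a → morph σ (τ a) ≡ morph χ (ρ a)) →
                  morph σ ∘ morph τ ≗ morph χ ∘ morph ρ
morph-conjugate σ τ ρ χ onLetters []      = refl
morph-conjugate σ τ ρ χ onLetters (a ∷ w) = begin
  morph σ (τ a ++ morph τ w)              ≡⟨ concatMap-++ σ (τ a) (morph τ w) ⟩
  morph σ (τ a) ++ morph σ (morph τ w)    ≡⟨ cong₂ _++_ (onLetters a) (morph-conjugate σ τ ρ χ onLetters w) ⟩
  morph χ (ρ a) ++ morph χ (morph ρ w)    ≡⟨ concatMap-++ χ (ρ a) (morph ρ w) ⟨
  morph χ (ρ a ++ morph ρ w)              ∎

iter-conjugate : {A B : Set} (g : B → B) (h : A → A) (k : A → B) →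
                 g ∘ k ≗ k ∘ h → ∀ n → iter n g ∘ k ≗ k ∘ iter n h
iter-conjugate g h k g∘k≗k∘h zero    x = refl
iter-conjugate g h k g∘k≗k∘h (suc n) x =
  trans (cong g (iter-conjugate g h k g∘k≗k∘h n x)) (g∘k≗k∘h (iter n h x))

f∘ψ≗ψ∘φ-letter : (a : Fin 5) → f (ψσ a) ≡ ψ (φσ a)
f∘ψ≗ψ∘φ-letter zero                         = refl
f∘ψ≗ψ∘φ-letter (suc zero)                   = refl
f∘ψ≗ψ∘φ-letter (suc (suc zero))             = refl
f∘ψ≗ψ∘φ-letter (suc (suc (suc zero)))       = refl
f∘ψ≗ψ∘φ-letter (suc (suc (suc (suc zero)))) = refl

f∘ψ≗ψ∘φ : f ∘ ψ ≗ ψ ∘ φ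
f∘ψ≗ψ∘φ = morph-conjugate fσ ψσ φσ ψσ f∘ψ≗ψ∘φ-letter

lemma1 : (n : ℕ) (w : Word 5) → iter n f (ψ w) ≡ ψ (iter n φ w)
lemma1 = iter-conjugate f φ ψ f∘ψ≗ψ∘φ
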